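{- Let $G$ be a thin graph and $(v,w)$ an edge of $G$, and let $N^*=N^*_{v,w}$. Then $|S_{N^*}(v)|=1$ and $|S_{N^*}(w)|=1$; in particular, the edge $(v,w)$ satisfies the S1-condition in $N^*$.
   Context: All graphs are finite, simple, connected, undirected. $N[v]$ is the closed neighborhood of $v$ in $G$, and $\langle W\rangle$ is the induced subgraph on $W$. $G$ is thin if no two distinct vertices have equal closed neighborhoods. $N^*_{v,w}=\langle\bigcup_{x\in N[v]\cap N[w]}N[x]\rangle$. For an induced subgraph $H$ and $x\in V(H)$, $S_H(x)=\{u\in V(H): N[u]\cap V(H)=N[x]\cap V(H)\}$. An edge $(a,b)$ satisfies the S1-condition in $H$ if $a,b\in V(H)$ and $|S_H(a)|=1$ or $|S_H(b)|=1$. -}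

module Defs where

open import Data.Nat using (ℕ; zero; suc)
open import Data.Fin using (Fin)
open import Data.Fin.Properties using (_≟_)
open import Data.Bool using (Bool; true; false; _∧_; _∨_; not; if_then_else_)
open import Data.Bool.Properties using () renaming (_≟_ to _≟ᵇ_)
open import Data.List using (List; []; _∷_; allFin; filter; length)
open import Data.Bool.ListAction using (any; all)
open import Relation.Nullary using (¬_; does)
open import Relation.Binary.PropositionalEquality using (_≡_)

record Graph (n : ℕ) : Set where
  field
    adj     : Fin n → Fin n → Bool
    sym     : ∀ u v → adj u v ≡ adj v u
    irrefl  : ∀ u → adj u u ≡ false
open Graph public

data Walk {n : ℕ} (G : Graph n) : Fin n → Fin n → Set where
  here : ∀ {u} → Walk G u u
  step : ∀ {u w v} → adj G u w ≡ true → Walk G w v → Walk G u v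

Connected : ∀ {n} → Graph n → Set
Connected G = ∀ u v → Walk G u v

-- closed neighbourhood membership: u ∈ N[v]
cl : ∀ {n} → Graph n → Fin n → Fin n → Bool
cl G v u = does (u ≟ v) ∨ adj G v u

Thin : ∀ {n} → Graph n → Set
Thin G = ∀ v w → (∀ u → cl G v u ≡ cl G w u) → v ≡ w

-- vertex set of N*_{v,w} = ⋃_{x ∈ N[v] ∩ N[w]} N[x]
inNstar : ∀ {n} → Graph n → Fin n → Fin n → Fin n → Bool
inNstar {n} G v w u = any (λ x → cl G v x ∧ cl G w x ∧ cl G x u) (allFin n)

-- S_H(x) for the induced subgraph H on the vertex set given by predicate P:
-- u ∈ S_H(x) iff u ∈ V(H) and N[u] ∩ V(H) = N[x] ∩ V(H)
inS : ∀ {n} → Graph n → (Fin n → Bool) → Fin n → Fin n → Bool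
inS {n} G P x u =
  P u ∧ all (λ y → not (P y) ∨ does (cl G u y ≟ᵇ cl G x y)) (allFin n)

cardS : ∀ {n} → Graph n → (Fin n → Bool) → Fin n → ℕ
cardS {n} G P x = length (filter (λ u → inS G P x u ≟ᵇ true) (allFin n))

-- Every x ∈ N[v] ∩ N[w] has N[x] ⊆ N*, and v, w ∈ N[x].  If u ∈ S_{N*}(x), then u sees
-- v and w as x does, so u ∈ N[v] ∩ N[w] and N[u] ⊆ N* too; two closed neighbourhoods
-- inside N* that agree on N* are equal, and thinness forces u = x.
module Submission where

open import Defs hiding (sym)
open import Data.Nat using (ℕ; _+_)
open import Data.Fin using (Fin; zero; suc)
open import Data.Fin.Properties using (0≢1+n; suc-injective; _≟_)
open import Data.Bool using (Bool; true; false; T)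
open import Data.Bool.Properties using (T-≡; T-∧; T-∨; T-not-≡) renaming (_≟_ to _≟ᵇ_)
open import Data.Product using (_×_; _,_; proj₂)
open import Data.Sum using (inj₁; inj₂)
open import Data.List using (length; filter; tabulate; allFin)
open import Data.List.Properties using (filter-accept; filter-reject; filter-none)
open import Data.List.Membership.Propositional using (lose)
open import Data.List.Membership.Propositional.Properties using (∈-allFin)
open import Data.List.Relation.Unary.All using (All; lookup)
open import Data.List.Relation.Unary.All.Properties using (tabulate⁺; all⁺; all⁻)
open import Data.List.Relation.Unary.Any.Properties using (any⁺)
open import Function using (_∘_; Equivalence)
open import Relation.Nullary using (¬_; Dec; yes; no; does; contradiction)
open import Relation.Unary using (Pred; Decidable)
open import Relation.Binary.PropositionalEquality
  using (_≡_; refl; sym; cong; subst; module ≡-Reasoning)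

open Equivalence using (to; from)

length-filter-tabulate-≡1 : ∀ {a p} {A : Set a} {P : Pred A p} (P? : Decidable P)
  {n} (f : Fin n → A) (k : Fin n) →
  P (f k) → (∀ i → P (f i) → i ≡ k) → length (filter P? (tabulate f)) ≡ 1
length-filter-tabulate-≡1 {P = P} P? f zero Pfk only = begin
  length (filter P? (tabulate f))                 ≡⟨ cong length (filter-accept P? Pfk) ⟩
  1 + length (filter P? (tabulate (f ∘ suc)))     ≡⟨ cong (λ xs → 1 + length xs) (filter-none P? none) ⟩
  1                                               ∎
  where
  open ≡-Reasoning
  none : All (¬_ ∘ P) (tabulate (f ∘ suc))
  none = tabulate⁺ λ i Pfi → 0≢1+n (sym (only (suc i) Pfi))
length-filter-tabulate-≡1 P? f (suc k) Pfk only = begin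
  length (filter P? (tabulate f))                 ≡⟨ cong length (filter-reject P? (0≢1+n ∘ only zero)) ⟩
  length (filter P? (tabulate (f ∘ suc)))         ≡⟨ length-filter-tabulate-≡1 P? (f ∘ suc) k Pfk
                                                       (λ i → suc-injective ∘ only (suc i)) ⟩
  1                                               ∎
  where open ≡-Reasoning

T-does⇒ : ∀ {a} {A : Set a} (a? : Dec A) → T (does a?) → A
T-does⇒ (yes a) _ = a

⇒T-does : ∀ {a} {A : Set a} (a? : Dec A) → A → T (does a?)
⇒T-does (yes _) _  = _
⇒T-does (no ¬a) a = ¬a a

T-injective : ∀ {b c} → (T b → T c) → (T c → T b) → b ≡ c
T-injective {false} {false} _   _   = refl
T-injective {false} {true}  _   c⇒b = contradiction (c⇒b _) λ ()
T-injective {true}  {false} b⇒c _   = contradiction (b⇒c _) λ ()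
T-injective {true}  {true}  _   _   = refl

module _ {n : ℕ} (G : Graph n) where

  N[_]⊆_ : Fin n → (Fin n → Bool) → Set
  N[ x ]⊆ P = ∀ {y} → T (cl G x y) → T (P y)

  cl-refl : ∀ x → T (cl G x x)
  cl-refl x = from T-∨ (inj₁ (⇒T-does (x ≟ x) refl))

  cl-sym : ∀ {x y} → T (cl G x y) → T (cl G y x)
  cl-sym {x} {y} xy with to T-∨ xy
  ... | inj₁ y≡x = subst (λ z → T (cl G z x)) (sym (T-does⇒ (y ≟ x) y≡x)) (cl-refl x)
  ... | inj₂ x~y = from T-∨ (inj₂ (subst T (Graph.sym G x y) x~y))

  adj⇒cl : ∀ {x y} → adj G x y ≡ true → T (cl G x y)
  adj⇒cl xy = from T-∨ (inj₂ (from T-≡ xy))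

  module _ (P : Fin n → Bool) where

    inS-refl : ∀ {x} → T (P x) → T (inS G P x x)
    inS-refl {x} Px = from T-∧ (Px , all⁻ _ (tabulate⁺ λ y →
      from T-∨ (inj₂ (⇒T-does (cl G x y ≟ᵇ cl G x y) refl))))

    inS-agrees : ∀ {x u} → T (inS G P x u) → ∀ {y} → T (P y) → cl G u y ≡ cl G x y
    inS-agrees {x} {u} Su {y} Py with to T-∨ (lookup (all⁺ _ (allFin n) (proj₂ (to T-∧ Su))) (∈-allFin y))
    ... | inj₁ ¬Py = contradiction (subst T (to T-not-≡ ¬Py) Py) λ ()
    ... | inj₂ u≈x = T-does⇒ (cl G u y ≟ᵇ cl G x y) u≈x

    inS-unique : Thin G → ∀ {x u} → N[ x ]⊆ P → N[ u ]⊆ P → T (inS G P x u) → u ≡ x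
    inS-unique thin {x} {u} x⊆P u⊆P Su = thin u x λ y →
      T-injective (λ uy → subst T (agree (u⊆P uy)) uy)
                  (λ xy → subst T (sym (agree (x⊆P xy))) xy)
      where
      agree : ∀ {y} → T (P y) → cl G u y ≡ cl G x y
      agree = inS-agrees Su

  Nstar-⊇ : ∀ {v w x} → T (cl G v x) → T (cl G w x) → N[ x ]⊆ inNstar G v w
  Nstar-⊇ {x = x} vx wx xy = any⁺ _ (lose (∈-allFin x) (from T-∧ (vx , from T-∧ (wx , xy))))

  module _ (thin : Thin G) {v w x : Fin n} (vx : T (cl G v x)) (wx : T (cl G w x)) where

    inS-Nstar-unique : ∀ {u} → T (inS G (inNstar G v w) x u) → u ≡ x
    inS-Nstar-unique {u} Su = inS-unique (inNstar G v w) thin x⊆N* (Nstar-⊇ (sees vx) (sees wx)) Su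
      where
      x⊆N* : N[ x ]⊆ inNstar G v w
      x⊆N* = Nstar-⊇ vx wx
      sees : ∀ {z} → T (cl G z x) → T (cl G z u)
      sees zx = cl-sym (subst T (sym (inS-agrees (inNstar G v w) Su (x⊆N* (cl-sym zx)))) (cl-sym zx))

    cardS-Nstar≡1 : cardS G (inNstar G v w) x ≡ 1
    cardS-Nstar≡1 = length-filter-tabulate-≡1 _ (λ u → u) x
      (to T-≡ (inS-refl (inNstar G v w) (Nstar-⊇ vx wx (cl-refl x))))
      (λ u Su → inS-Nstar-unique (from T-≡ Su))

lemma3p24 : ∀ {n : ℕ} (G : Graph n) → Connected G → Thin G →
    (v w : Fin n) → adj G v w ≡ true →
    (cardS G (inNstar G v w) v ≡ 1) × (cardS G (inNstar G v w) w ≡ 1)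
lemma3p24 G _ thin v w vw =
  cardS-Nstar≡1 G thin (cl-refl G v) (cl-sym G vw′) , cardS-Nstar≡1 G thin vw′ (cl-refl G w)
  where
  vw′ : T (cl G v w)
  vw′ = adj⇒cl G vw
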